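{- Let $n,r,k,t$ be integers with $n\geq r+1$, $r+1\geq 3k+2t$, $k+t\geq 2$, $k\geq 1$, $t\geq 0$. Then $\sigma(K_{r+1}-(kP_2\cup tK_2), n)\geq (r-1)(2n-r)-2(n-r)$.
   Context: A non-increasing sequence $\pi=(d_1,\dots,d_n)$ of nonnegative integers is graphic if it is the degree sequence of a simple graph on $n$ vertices (a realization of $\pi$); $\sigma(\pi)=d_1+\cdots+d_n$. For a graph $F$, $\pi$ is potentially $F$-graphic if some realization of $\pi$ contains $F$ as a subgraph. $\sigma(F,n)$ denotes the smallest even integer $l$ such that every $n$-term graphic sequence $\pi$ with $\sigma(\pi)\geq l$ is potentially $F$-graphic. $K_m$ is the complete graph on $m$ vertices; $P_2$ denotes the path with 2 edges (on 3 vertices); $K_2$ is a single edge; $kP_2\cup tK_2$ is the disjoint union of $k$ copies of $P_2$ and $t$ copies of $K_2$. For a subgraph $H$ of $K_m$, $K_m-H$ is the graph obtained from $K_m$ by deleting the edges of $H$; here $kP_2\cup tK_2$ is regarded as a subgraph of $K_{r+1}$. -}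

module Defs where

open import Data.Bool using (Bool; true; false; not; _∧_; _∨_; if_then_else_)
open import Data.Bool.Properties using (∨-comm)
open import Data.Nat using (ℕ; zero; suc; _+_; _*_; _∸_; _≤_; _<ᵇ_; _≤ᵇ_; _≡ᵇ_; _%_)
open import Data.Nat.Divisibility using (_∣_)
open import Data.Fin using (Fin; toℕ)
open import Data.List using (List; map; allFin)
open import Data.Nat.ListAction using (sum)
open import Data.Product using (Σ; _×_; ∃)
open import Function.Definitions using (Injective)
open import Relation.Binary.PropositionalEquality using (_≡_; refl; cong₂)

record Graph (n : ℕ) : Set where
  field
    adj    : Fin n → Fin n → Bool
    sym    : ∀ u v → adj u v ≡ adj v u
    irrefl : ∀ v → adj v v ≡ false
open Graph public

countFin : (n : ℕ) → (Fin n → Bool) → ℕ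
countFin n P = sum (map (λ u → if P u then 1 else 0) (allFin n))

deg : {n : ℕ} → Graph n → Fin n → ℕ
deg {n} G v = countFin n (adj G v)

σ : {n : ℕ} → (Fin n → ℕ) → ℕ
σ {n} π = sum (map π (allFin n))

NonIncreasing : {n : ℕ} → (Fin n → ℕ) → Set
NonIncreasing π = ∀ i j → toℕ i ≤ toℕ j → π j ≤ π i

Realizes : {n : ℕ} → Graph n → (Fin n → ℕ) → Set
Realizes G π = ∀ i → deg G i ≡ π i

Graphic : {n : ℕ} → (Fin n → ℕ) → Set
Graphic {n} π = NonIncreasing π × ∃ λ (G : Graph n) → Realizes G π

SubgraphOf : {m n : ℕ} → Graph m → Graph n → Set
SubgraphOf {m} {n} F G =
  Σ (Fin m → Fin n) λ f → Injective _≡_ _≡_ f ×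
    (∀ u v → adj F u v ≡ true → adj G (f u) (f v) ≡ true)

PotentiallyGraphic : {m n : ℕ} → Graph m → (Fin n → ℕ) → Set
PotentiallyGraphic {m} {n} F π = Σ (Graph n) λ G → Realizes G π × SubgraphOf F G

SigmaProp : {m : ℕ} → Graph m → ℕ → ℕ → Set
SigmaProp F n l = (π : Fin n → ℕ) → Graphic π → l ≤ σ π → PotentiallyGraphic F π

Even : ℕ → Set
Even l = 2 ∣ l

-- The graph K_{r+1} - (k P_2 ∪ t K_2) on vertex set Fin (r+1).
-- Copy i < k of P_2 uses vertices 3i, 3i+1, 3i+2 with edges {3i,3i+1},{3i+1,3i+2};
-- copy j < t of K_2 uses vertices 3k+2j, 3k+2j+1 with edge {3k+2j,3k+2j+1}.
-- (This requires 3k+2t ≤ r+1.)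

startsRemoved : ℕ → ℕ → ℕ → Bool
startsRemoved k t a =
  ((a <ᵇ 3 * k) ∧ not (a % 3 ≡ᵇ 2))
  ∨ ((3 * k ≤ᵇ a) ∧ (a <ᵇ 3 * k + 2 * t) ∧ ((a ∸ 3 * k) % 2 ≡ᵇ 0))

removed : ℕ → ℕ → ℕ → ℕ → Bool
removed k t a b = (suc a ≡ᵇ b) ∧ startsRemoved k t a

removedSym : ℕ → ℕ → ℕ → ℕ → Bool
removedSym k t a b = removed k t a b ∨ removed k t b a

≡ᵇ-sym : ∀ a b → (a ≡ᵇ b) ≡ (b ≡ᵇ a)
≡ᵇ-sym zero zero = refl
≡ᵇ-sym zero (suc b) = refl
≡ᵇ-sym (suc a) zero = refl
≡ᵇ-sym (suc a) (suc b) = ≡ᵇ-sym a b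

≡ᵇ-refl : ∀ a → (a ≡ᵇ a) ≡ true
≡ᵇ-refl zero = refl
≡ᵇ-refl (suc a) = ≡ᵇ-refl a

KminusAdj : (r k t : ℕ) → Fin (suc r) → Fin (suc r) → Bool
KminusAdj r k t u v = not (toℕ u ≡ᵇ toℕ v) ∧ not (removedSym k t (toℕ u) (toℕ v))

KminusSym : ∀ r k t u v → KminusAdj r k t u v ≡ KminusAdj r k t v u
KminusSym r k t u v =
  cong₂ (λ x y → not x ∧ not y) (≡ᵇ-sym (toℕ u) (toℕ v))
    (∨-comm (removed k t (toℕ u) (toℕ v)) (removed k t (toℕ v) (toℕ u)))

KminusIrrefl : ∀ r k t v → KminusAdj r k t v v ≡ false
KminusIrrefl r k t v rewrite ≡ᵇ-refl (toℕ v) = refl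

KminusPK : (r k t : ℕ) → Graph (suc r)
KminusPK r k t = record
  { adj = KminusAdj r k t ; sym = KminusSym r k t ; irrefl = KminusIrrefl r k t }

{-# OPTIONS --safe #-}
-- With a = r − 2, let π = ((n−1)^a, a^(n−a)), the degree sequence of K_a joined to n − a
-- independent vertices; σ(π) is even and σ(π) + 2 is exactly the claimed bound. Degree counting
-- shows that every realization of π is this split graph: a vertex of degree n − 1 sees all
-- others, so a vertex of degree a has all its neighbours among the a high vertices. The removed
-- edges of K_{r+1} − (kP₂ ∪ tK₂) join consecutive vertices only, so its even and its odd
-- vertices form two cliques. An embedding sends at most a vertices to the high part and at most
-- one vertex of each clique to the independent low part, so r + 1 ≤ a + 2, which is false.
-- Hence π is not potentially graphic, so σ(π) < l, and parity gives σ(π) + 2 ≤ l.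
module Submission where

open import Defs hiding (sym)
open import Data.Bool using (Bool; true; false; not; _∧_; _∨_; if_then_else_; T)
open import Data.Bool.Properties using (∨-comm; ∧-identityʳ; ∧-zeroʳ)
open import Data.Fin as Fin using (Fin; toℕ; fromℕ<; join; splitAt)
open import Data.Fin.Properties
  using (injective⇒≤; splitAt-join; toℕ-injective; fromℕ<-injective; toℕ<n)
open import Data.List using (map; allFin)
open import Data.List.Properties using (map-tabulate; map-cong)
open import Data.Nat using (ℕ; zero; suc; _+_; _*_; _∸_; _≤_; _<_; _<ᵇ_; _≡ᵇ_; z≤n; s≤s; s≤s⁻¹)
open import Data.Nat.Divisibility using (_∣_; divides; ∣m∣n⇒∣m+n; m∣m*n)
open import Data.Nat.ListAction using (sum)
open import Data.Nat.Properties
open import Data.Nat.Tactic.RingSolver using (solve-∀)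
open import Data.Product using (_,_)
open import Data.Sum using (_⊎_; inj₁; inj₂)
open import Data.Sum.Properties using (inj₁-injective; inj₂-injective)
open import Function using (_∘_; id)
open import Function.Definitions using (Injective)
open import Relation.Nullary using (¬_; yes; no; contradiction)
open import Relation.Nullary.Decidable using (dec-true; dec-false)
open import Relation.Binary.PropositionalEquality
  using (_≡_; _≢_; refl; sym; trans; cong; cong₂; subst; module ≡-Reasoning)

≡ᵇ≡false : ∀ {m n} → m ≢ n → (m ≡ᵇ n) ≡ false
≡ᵇ≡false {m} {n} = dec-false (m ≟ n)

<ᵇ≡true : ∀ {m n} → m < n → (m <ᵇ n) ≡ true
<ᵇ≡true {m} {n} = dec-true (m <? n)

<ᵇ≡false : ∀ {m n} → n ≤ m → (m <ᵇ n) ≡ false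
<ᵇ≡false {m} {n} n≤m = dec-false (m <? n) (≤⇒≯ n≤m)

<ᵇ≡true⇒< : ∀ {m n} → (m <ᵇ n) ≡ true → m < n
<ᵇ≡true⇒< {m} {n} eq = <ᵇ⇒< m n (subst T (sym eq) _)

indicator : Bool → ℕ
indicator b = if b then 1 else 0

indicator-mono : ∀ {b c} → (b ≡ true → c ≡ true) → indicator b ≤ indicator c
indicator-mono {false} _   = z≤n
indicator-mono {true}  b⇒c rewrite b⇒c refl = ≤-refl

sum-allFin-suc : ∀ n (f : Fin (suc n) → ℕ) →
  sum (map f (allFin (suc n))) ≡ f Fin.zero + sum (map (f ∘ Fin.suc) (allFin n))
sum-allFin-suc n f = cong (λ xs → f Fin.zero + sum xs)
  (trans (map-tabulate Fin.suc f) (sym (map-tabulate id (f ∘ Fin.suc))))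

countFin-suc : ∀ n (P : Fin (suc n) → Bool) →
  countFin (suc n) P ≡ indicator (P Fin.zero) + countFin n (P ∘ Fin.suc)
countFin-suc n P = sum-allFin-suc n (indicator ∘ P)

countFin-cong : ∀ n {P Q : Fin n → Bool} → (∀ u → P u ≡ Q u) → countFin n P ≡ countFin n Q
countFin-cong n P≗Q = cong sum (map-cong (cong indicator ∘ P≗Q) (allFin n))

countFin-false : ∀ n → countFin n (λ _ → false) ≡ 0
countFin-false zero    = refl
countFin-false (suc n) = trans (countFin-suc n (λ _ → false)) (countFin-false n)

countFin-true : ∀ n → countFin n (λ _ → true) ≡ n
countFin-true zero    = refl
countFin-true (suc n) = trans (countFin-suc n (λ _ → true)) (cong suc (countFin-true n))

countFin-mono : ∀ n {P Q : Fin n → Bool} → (∀ u → P u ≡ true → Q u ≡ true) →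
  countFin n P ≤ countFin n Q
countFin-mono zero    _ = z≤n
countFin-mono (suc n) {P} {Q} P⇒Q = begin
  countFin (suc n) P                                ≡⟨ countFin-suc n P ⟩
  indicator (P Fin.zero) + countFin n (P ∘ Fin.suc) ≤⟨ +-mono-≤ (indicator-mono (P⇒Q Fin.zero))
                                                                 (countFin-mono n (P⇒Q ∘ Fin.suc)) ⟩
  indicator (Q Fin.zero) + countFin n (Q ∘ Fin.suc) ≡⟨ countFin-suc n Q ⟨
  countFin (suc n) Q                                ∎
  where open ≤-Reasoning

countFin-mono-< : ∀ n {P Q : Fin n → Bool} → (∀ u → P u ≡ true → Q u ≡ true) →
  ∀ w → P w ≡ false → Q w ≡ true → countFin n P < countFin n Q
countFin-mono-< (suc n) {P} {Q} P⇒Q Fin.zero Pw Qw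
  rewrite countFin-suc n P | countFin-suc n Q | Pw | Qw = s≤s (countFin-mono n (P⇒Q ∘ Fin.suc))
countFin-mono-< (suc n) {P} {Q} P⇒Q (Fin.suc w) Pw Qw = begin-strict
  countFin (suc n) P                                ≡⟨ countFin-suc n P ⟩
  indicator (P Fin.zero) + countFin n (P ∘ Fin.suc) <⟨ +-mono-≤-< (indicator-mono (P⇒Q Fin.zero))
                                                                   (countFin-mono-< n (P⇒Q ∘ Fin.suc) w Pw Qw) ⟩
  indicator (Q Fin.zero) + countFin n (Q ∘ Fin.suc) ≡⟨ countFin-suc n Q ⟨
  countFin (suc n) Q                                ∎
  where open ≤-Reasoning

countFin-≢ : ∀ {m} (v : Fin (suc m)) → countFin (suc m) (λ u → not (toℕ u ≡ᵇ toℕ v)) ≡ m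
countFin-≢ {m} Fin.zero =
  trans (countFin-suc m (λ u → not (toℕ u ≡ᵇ 0))) (countFin-true m)
countFin-≢ {suc m} (Fin.suc v) =
  trans (countFin-suc (suc m) (λ u → not (toℕ u ≡ᵇ suc (toℕ v)))) (cong suc (countFin-≢ v))

countFin-< : ∀ {n a} → a ≤ n → countFin n (λ u → toℕ u <ᵇ a) ≡ a
countFin-< {n}     {zero}  _         = countFin-false n
countFin-< {suc n} {suc a} (s≤s a≤n) =
  trans (countFin-suc n (λ u → toℕ u <ᵇ suc a)) (cong suc (countFin-< a≤n))

σ-const : ∀ n y → σ {n} (λ _ → y) ≡ n * y
σ-const zero    y = refl
σ-const (suc n) y = trans (sum-allFin-suc n (λ _ → y)) (cong (y +_) (σ-const n y))

σ-threshold : ∀ n {a} x y → a ≤ n →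
  σ {n} (λ i → if toℕ i <ᵇ a then x else y) ≡ a * x + (n ∸ a) * y
σ-threshold n       {zero}  x y _         = σ-const n y
σ-threshold (suc n) {suc a} x y (s≤s a≤n) = begin
  σ {suc n} (λ i → if toℕ i <ᵇ suc a then x else y) ≡⟨ sum-allFin-suc n _ ⟩
  x + σ {n} (λ i → if toℕ i <ᵇ a then x else y)      ≡⟨ cong (x +_) (σ-threshold n x y a≤n) ⟩
  x + (a * x + (n ∸ a) * y)                           ≡⟨ +-assoc x (a * x) ((n ∸ a) * y) ⟨
  suc a * x + (suc n ∸ suc a) * y                     ∎
  where open ≡-Reasoning

adjacent⇒≢ : ∀ {n} (G : Graph n) {v w} → adj G v w ≡ true → v ≢ w
adjacent⇒≢ G {v} vw refl = contradiction (trans (sym vw) (irrefl G v)) λ ()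

nonadjacent⇒deg< : ∀ {m} (G : Graph (suc m)) {v w} → v ≢ w → adj G v w ≡ false → deg G v < m
nonadjacent⇒deg< {m} G {v} {w} v≢w vw = begin-strict
  deg G v                                        <⟨ countFin-mono-< (suc m) neighbour≢ w vw
                                                      (cong not (≡ᵇ≡false (v≢w ∘ sym ∘ toℕ-injective))) ⟩
  countFin (suc m) (λ u → not (toℕ u ≡ᵇ toℕ v)) ≡⟨ countFin-≢ v ⟩
  m                                              ∎
  where
  open ≤-Reasoning
  neighbour≢ : ∀ u → adj G v u ≡ true → not (toℕ u ≡ᵇ toℕ v) ≡ true
  neighbour≢ u vu = cong not (≡ᵇ≡false (adjacent⇒≢ G vu ∘ sym ∘ toℕ-injective))

splitSeq : (m a : ℕ) → Fin (suc m) → ℕ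
splitSeq m a i = if toℕ i <ᵇ a then m else a

splitSeq-high : ∀ {m a i} → toℕ i < a → splitSeq m a i ≡ m
splitSeq-high i<a rewrite <ᵇ≡true i<a = refl

splitSeq-low : ∀ {m a i} → a ≤ toℕ i → splitSeq m a i ≡ a
splitSeq-low a≤i rewrite <ᵇ≡false a≤i = refl

splitGraph : (m a : ℕ) → Graph (suc m)
splitGraph m a = record
  { adj    = λ u v → not (toℕ u ≡ᵇ toℕ v) ∧ ((toℕ u <ᵇ a) ∨ (toℕ v <ᵇ a))
  ; sym    = λ u v → cong₂ (λ e h → not e ∧ h)
                        (≡ᵇ-sym (toℕ u) (toℕ v)) (∨-comm (toℕ u <ᵇ a) (toℕ v <ᵇ a))
  ; irrefl = λ v → cong (λ e → not e ∧ ((toℕ v <ᵇ a) ∨ (toℕ v <ᵇ a))) (≡ᵇ-refl (toℕ v))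
  }

splitGraph-realizes : ∀ {m a} → a ≤ suc m → Realizes (splitGraph m a) (splitSeq m a)
splitGraph-realizes {m} {a} a≤1+m i with toℕ i <? a
... | yes i<a = begin
  deg (splitGraph m a) i                          ≡⟨ countFin-cong (suc m) high-row ⟩
  countFin (suc m) (λ u → not (toℕ u ≡ᵇ toℕ i)) ≡⟨ countFin-≢ i ⟩
  m                                               ≡⟨ splitSeq-high i<a ⟨
  splitSeq m a i                                  ∎
  where
  open ≡-Reasoning
  high-row : ∀ u → adj (splitGraph m a) i u ≡ not (toℕ u ≡ᵇ toℕ i)
  high-row u rewrite <ᵇ≡true i<a = trans (∧-identityʳ _) (cong not (≡ᵇ-sym (toℕ i) (toℕ u)))
... | no i≮a = begin
  deg (splitGraph m a) i                     ≡⟨ countFin-cong (suc m) low-row ⟩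
  countFin (suc m) (λ u → toℕ u <ᵇ a)       ≡⟨ countFin-< a≤1+m ⟩
  a                                          ≡⟨ splitSeq-low (≮⇒≥ i≮a) ⟨
  splitSeq m a i                             ∎
  where
  open ≡-Reasoning
  low-row : ∀ u → adj (splitGraph m a) i u ≡ (toℕ u <ᵇ a)
  low-row u with toℕ u <? a
  ... | yes u<a rewrite <ᵇ≡false (≮⇒≥ i≮a) | <ᵇ≡true u<a =
    trans (∧-identityʳ _) (cong not (≡ᵇ≡false λ i≡u → i≮a (subst (_< a) (sym i≡u) u<a)))
  ... | no u≮a rewrite <ᵇ≡false (≮⇒≥ i≮a) | <ᵇ≡false (≮⇒≥ u≮a) = ∧-zeroʳ _

splitSeq-≥ : ∀ {m a} → a ≤ m → ∀ i → a ≤ splitSeq m a i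
splitSeq-≥ {a = a} a≤m i with toℕ i <? a
... | yes i<a = subst (_ ≤_) (sym (splitSeq-high i<a)) a≤m
... | no  i≮a = ≤-reflexive (sym (splitSeq-low (≮⇒≥ i≮a)))

splitSeq-nonIncreasing : ∀ {m a} → a ≤ m → NonIncreasing (splitSeq m a)
splitSeq-nonIncreasing {a = a} a≤m i j i≤j with toℕ j <? a
... | yes j<a = ≤-reflexive (trans (splitSeq-high j<a) (sym (splitSeq-high (≤-<-trans i≤j j<a))))
... | no  j≮a = ≤-trans (≤-reflexive (splitSeq-low (≮⇒≥ j≮a))) (splitSeq-≥ a≤m i)

splitSeq-graphic : ∀ {m a} → a ≤ m → Graphic (splitSeq m a)
splitSeq-graphic {m} {a} a≤m =
  splitSeq-nonIncreasing a≤m , splitGraph m a , splitGraph-realizes (m≤n⇒m≤1+n a≤m)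

module _ {m a} {G : Graph (suc m)} (G-realizes : Realizes G (splitSeq m a)) where

  splitSeq-high-adjacent : ∀ {v w} → toℕ v < a → v ≢ w → adj G v w ≡ true
  splitSeq-high-adjacent {v} {w} v<a v≢w with adj G v w in vw
  ... | true  = refl
  ... | false = contradiction (trans (G-realizes v) (splitSeq-high v<a))
                              (<⇒≢ (nonadjacent⇒deg< G v≢w vw))

  splitSeq-low-independent : ∀ {v w} → a ≤ toℕ v → a ≤ toℕ w → adj G v w ≡ false
  splitSeq-low-independent {v} {w} a≤v a≤w with adj G v w in vw
  ... | false = refl
  ... | true  = contradiction (trans (G-realizes v) (splitSeq-low a≤v)) (>⇒≢ a<deg)
    where
    high⇒adjacent : ∀ u → (toℕ u <ᵇ a) ≡ true → adj G v u ≡ true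
    high⇒adjacent u u<ᵇa = trans (Graph.sym G v u)
      (splitSeq-high-adjacent (<ᵇ≡true⇒< u<ᵇa) λ { refl → <⇒≱ (<ᵇ≡true⇒< u<ᵇa) a≤v })
    a<deg : a < deg G v
    a<deg = begin-strict
      a                                    ≡⟨ countFin-< (<⇒≤ (≤-<-trans a≤v (toℕ<n v))) ⟨
      countFin (suc m) (λ u → toℕ u <ᵇ a) <⟨ countFin-mono-< (suc m) high⇒adjacent w (<ᵇ≡false a≤w) vw ⟩
      deg G v                              ∎
      where open ≤-Reasoning

record CliqueCover {p} (q : ℕ) (F : Graph p) : Set where
  constructor cliqueCover
  field
    colour              : Fin p → Fin q
    same-colour⇒adjacent : ∀ x y → x ≢ y → colour x ≡ colour y → adj F x y ≡ true

splitSeq-embedding-bound : ∀ {m a p q} {F : Graph p} {G : Graph (suc m)} →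
  Realizes G (splitSeq m a) → CliqueCover q F → SubgraphOf F G → p ≤ q + a
splitSeq-embedding-bound {m} {a} {p} {q} {F} {G} G-realizes
  (cliqueCover colour same-colour⇒adjacent) (f , f-injective , f-edges) =
  injective⇒≤ {f = join q a ∘ side} (side-injective ∘ join-injective)
  where
  side : Fin p → Fin q ⊎ Fin a
  side x with toℕ (f x) <? a
  ... | yes fx<a = inj₂ (fromℕ< fx<a)
  ... | no  _    = inj₁ (colour x)

  join-injective : Injective _≡_ _≡_ (join q a)
  join-injective {x} {y} eq =
    trans (sym (splitAt-join q a x)) (trans (cong (splitAt q) eq) (splitAt-join q a y))

  side-injective : Injective _≡_ _≡_ side
  side-injective {x} {y} eq with toℕ (f x) <? a | toℕ (f y) <? a
  side-injective {x} {y} eq | yes fx<a | yes fy<a =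
    f-injective (toℕ-injective (fromℕ<-injective _ _ fx<a fy<a (inj₂-injective eq)))
  side-injective {x} {y} () | yes _ | no _
  side-injective {x} {y} () | no _  | yes _
  side-injective {x} {y} eq | no fx≮a | no fy≮a with x Fin.≟ y
  ... | yes x≡y = x≡y
  ... | no  x≢y = contradiction
    (trans (sym (f-edges x y (same-colour⇒adjacent x y x≢y (inj₁-injective eq))))
           (splitSeq-low-independent {G = G} G-realizes (≮⇒≥ fx≮a) (≮⇒≥ fy≮a)))
    λ ()

splitSeq-not-potentially : ∀ {m a p q} {F : Graph p} → CliqueCover q F → q + a < p →
  ¬ PotentiallyGraphic F (splitSeq m a)
splitSeq-not-potentially cover q+a<p (G , G-realizes , embedding) =
  <⇒≱ q+a<p (splitSeq-embedding-bound {G = G} G-realizes cover embedding)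

parity : ℕ → Fin 2
parity zero          = Fin.zero
parity (suc zero)    = Fin.suc Fin.zero
parity (suc (suc n)) = parity n

parity-suc : ∀ n → parity (suc n) ≢ parity n
parity-suc zero          ()
parity-suc (suc zero)    ()
parity-suc (suc (suc n)) = parity-suc n

KminusAdj-nonconsecutive : ∀ r k t (u v : Fin (suc r)) →
  toℕ u ≢ toℕ v → suc (toℕ u) ≢ toℕ v → suc (toℕ v) ≢ toℕ u → KminusAdj r k t u v ≡ true
KminusAdj-nonconsecutive r k t u v u≢v 1+u≢v 1+v≢u
  rewrite ≡ᵇ≡false u≢v | ≡ᵇ≡false 1+u≢v | ≡ᵇ≡false 1+v≢u = refl

KminusPK-cliqueCover : ∀ r k t → CliqueCover 2 (KminusPK r k t)
KminusPK-cliqueCover r k t = cliqueCover (parity ∘ toℕ) λ x y x≢y same-parity →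
  KminusAdj-nonconsecutive r k t x y (x≢y ∘ toℕ-injective)
    (λ 1+x≡y → parity-suc (toℕ x) (trans (cong parity 1+x≡y) (sym same-parity)))
    (λ 1+y≡x → parity-suc (toℕ y) (trans (cong parity 1+y≡x) same-parity))

m≡n+o⇒m∸n≡o : ∀ {m} n {o} → m ≡ n + o → m ∸ n ≡ o
m≡n+o⇒m∸n≡o n {o} refl = m+n∸m≡n n o

2∣n*[1+n] : ∀ n → 2 ∣ n * suc n
2∣n*[1+n] zero    = divides 0 refl
2∣n*[1+n] (suc n) = subst (2 ∣_) (next n) (∣m∣n⇒∣m+n (2∣n*[1+n] n) (m∣m*n (suc n)))
  where
  next : ∀ n → n * suc n + 2 * suc n ≡ suc n * suc (suc n)
  next = solve-∀

even-<⇒2+≤ : ∀ {m n} → 2 ∣ m → 2 ∣ n → m < n → 2 + m ≤ n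
even-<⇒2+≤ (divides p refl) (divides q refl) 2p<2q = *-monoˡ-≤ 2 (*-cancelʳ-< 2 p q 2p<2q)

-- The right-hand side a(a+1) + 2(2+c)a displays the parity of the sum.
σ-splitSeq : ∀ a c → σ (splitSeq (2 + a + c) a) ≡ a * suc a + 2 * ((2 + c) * a)
σ-splitSeq a c = begin
  σ (splitSeq (2 + a + c) a)             ≡⟨ σ-threshold (3 + a + c) (2 + a + c) a a≤n ⟩
  a * (2 + a + c) + (3 + a + c ∸ a) * a ≡⟨ cong (λ x → a * (2 + a + c) + x * a)
                                                  (m≡n+o⇒m∸n≡o a (n≡a+[3+c] a c)) ⟩
  a * (2 + a + c) + (3 + c) * a         ≡⟨ regroup a c ⟩
  a * suc a + 2 * ((2 + c) * a)         ∎
  where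
  open ≡-Reasoning
  a≤n : a ≤ 3 + a + c
  a≤n = ≤-trans (m≤n+m a 3) (m≤m+n (3 + a) c)
  n≡a+[3+c] : ∀ a c → 3 + a + c ≡ a + (3 + c)
  n≡a+[3+c] = solve-∀
  regroup : ∀ a c → a * (2 + a + c) + (3 + c) * a ≡ a * suc a + 2 * ((2 + c) * a)
  regroup = solve-∀

bound-splitSeq : ∀ a c → let n = 3 + a + c in
  (2 + a ∸ 1) * (2 * n ∸ (2 + a)) ∸ 2 * (n ∸ (2 + a)) ≡ 2 + (a * suc a + 2 * ((2 + c) * a))
bound-splitSeq a c = begin
  suc a * (2 * (3 + a + c) ∸ (2 + a)) ∸ 2 * (3 + a + c ∸ (2 + a))
    ≡⟨ cong₂ (λ x y → suc a * x ∸ 2 * y)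
             (m≡n+o⇒m∸n≡o (2 + a) (2n≡r+[4+a+2c] a c)) (m≡n+o⇒m∸n≡o (2 + a) (n≡r+[1+c] a c)) ⟩
  suc a * (4 + a + 2 * c) ∸ 2 * (1 + c)
    ≡⟨ m≡n+o⇒m∸n≡o (2 * (1 + c)) (expand a c) ⟩
  2 + (a * suc a + 2 * ((2 + c) * a)) ∎
  where
  open ≡-Reasoning
  2n≡r+[4+a+2c] : ∀ a c → 2 * (3 + a + c) ≡ (2 + a) + (4 + a + 2 * c)
  2n≡r+[4+a+2c] = solve-∀
  n≡r+[1+c] : ∀ a c → 3 + a + c ≡ (2 + a) + (1 + c)
  n≡r+[1+c] = solve-∀
  expand : ∀ a c → suc a * (4 + a + 2 * c) ≡ 2 * (1 + c) + (2 + (a * suc a + 2 * ((2 + c) * a)))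
  expand = solve-∀

3k+2t≤1+r⇒2≤r : ∀ {r} k t → 3 * k + 2 * t ≤ suc r → 1 ≤ k → 2 ≤ r
3k+2t≤1+r⇒2≤r k t 3k+2t≤1+r 1≤k =
  s≤s⁻¹ (≤-trans (*-monoʳ-≤ 3 1≤k) (≤-trans (m≤m+n (3 * k) (2 * t)) 3k+2t≤1+r))

lemma3p1 : (n r k t : ℕ) → suc r ≤ n → 3 * k + 2 * t ≤ suc r → 2 ≤ k + t → 1 ≤ k →
    (l : ℕ) → Even l → SigmaProp (KminusPK r k t) n l →
    (r ∸ 1) * (2 * n ∸ r) ∸ 2 * (n ∸ r) ≤ l
lemma3p1 n r k t r<n 3k+2t≤1+r _ 1≤k l l-even sp
  with a , refl ← m≤n⇒∃[o]m+o≡n (3k+2t≤1+r⇒2≤r k t 3k+2t≤1+r 1≤k)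
  with c , refl ← m≤n⇒∃[o]m+o≡n r<n = begin
    (r ∸ 1) * (2 * n ∸ r) ∸ 2 * (n ∸ r) ≡⟨ bound-splitSeq a c ⟩
    2 + (a * suc a + 2 * ((2 + c) * a)) ≡⟨ cong (2 +_) (σ-splitSeq a c) ⟨
    2 + σ π                              ≤⟨ even-<⇒2+≤ σπ-even l-even σπ<l ⟩
    l                                    ∎
  where
  open ≤-Reasoning
  π : Fin (3 + a + c) → ℕ
  π = splitSeq (2 + a + c) a
  σπ-even : 2 ∣ σ π
  σπ-even = subst (2 ∣_) (sym (σ-splitSeq a c))
    (∣m∣n⇒∣m+n (2∣n*[1+n] a) (m∣m*n ((2 + c) * a)))
  σπ<l : σ π < l
  σπ<l = ≰⇒> λ l≤σπ → splitSeq-not-potentially {a = a} (KminusPK-cliqueCover (2 + a) k t) ≤-refl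
    (sp π (splitSeq-graphic (≤-trans (m≤n+m a 2) (m≤m+n (2 + a) c))) l≤σπ)
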